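{- Let $p>2$ be a prime and let $Y\subset\mathbb{Z}_p$ with $|Y|>1$. Then $$|3Y^2-3Y^2|\geq\frac{|Y|^2(p-1)}{|Y|^2+p-1}.$$
   Context: $\mathbb{Z}_p$ is the field of residues modulo $p$. $Y^2=\{y_1y_2:\ y_1,y_2\in Y\}$, $kS=\{s_1+\dots+s_k:\ s_i\in S\}$, and $S-T=\{s-t:\ s\in S,t\in T\}$; so $3Y^2-3Y^2=\{s-t:\ s,t\in 3(Y^2)\}$. -}

module Defs where

open import Data.Nat using (ℕ; suc; _+_; _*_; _∸_; NonZero)
open import Data.Nat.DivMod using (_mod_)
open import Data.Fin using (Fin; toℕ)
open import Data.Fin.Properties using (any?)
open import Data.Fin.Subset using (Subset; _∈_)
open import Data.Fin.Subset.Properties using (_∈?_)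
open import Data.Vec using (tabulate)
open import Data.Product using (∃; _×_; _,_)
open import Data.Bool using (Bool)
open import Relation.Nullary using (Dec; does; _×-dec_)
open import Relation.Binary.PropositionalEquality using (_≡_)
open import Data.Fin.Properties using (_≟_)

-- Residues modulo p are represented by Fin p (canonical representatives 0..p-1).
module _ {p : ℕ} .{{_ : NonZero p}} where

  _+ₚ_ _*ₚ_ _-ₚ_ : Fin p → Fin p → Fin p
  a +ₚ b = (toℕ a + toℕ b) mod p
  a *ₚ b = (toℕ a * toℕ b) mod p
  a -ₚ b = (toℕ a + (p ∸ toℕ b)) mod p

  -- the set { a ∘ b : a ∈ A, b ∈ B } for a binary operation ∘ on ℤ_p
  image2 : (Fin p → Fin p → Fin p) → Subset p → Subset p → Subset p
  image2 _∘_ A B = tabulate λ z →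
    does (any? λ a → any? λ b → (a ∈? A) ×-dec ((b ∈? B) ×-dec (z ≟ (a ∘ b))))

  -- A·B, A+B, A−B (so Y² = Y·Y, 3S = S+S+S)
  prodSet sumSet diffSet : Subset p → Subset p → Subset p
  prodSet = image2 _*ₚ_
  sumSet  = image2 _+ₚ_
  diffSet = image2 _-ₚ_

  threeY²-threeY² : Subset p → Subset p
  threeY²-threeY² Y = diffSet S S
    where
    Y² = prodSet Y Y
    S  = sumSet (sumSet Y² Y²) Y²

{-# OPTIONS --safe #-}
-- For η ∈ ℤ_p let E(η) count the solutions of a + ηb = c + ηd with a, b, c, d ∈ Y. Two distinct pairs
-- (a, b) ≠ (c, d) collide for at most one η, so ∑_η E(η) ≤ p|Y|² + |Y|⁴. Let Q = (Y − Y)/(Y − Y).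
-- If (c − d)ξ = a − b with c ≠ d, then (c − d)(y₁ + (ξ + 1)y₂) = (cy₁ + ay₂ + cy₂) − (dy₁ + by₂ + dy₂),
-- so y₁ + (ξ + 1)y₂ takes at most |3Y² − 3Y²| values on Y², and Cauchy–Schwarz gives
-- |Y|⁴ ≤ |3Y² − 3Y²| E(ξ + 1). Since 0 ∈ Q, either Q = ℤ_p and summing over η gives
-- p|Y|⁴ ≤ |3Y² − 3Y²| (p|Y|² + |Y|⁴), or some ξ ∈ Q has ξ + 1 ∉ Q; then y₁ + (ξ + 1)y₂ is injective
-- on Y², E(ξ + 1) = |Y|², and |3Y² − 3Y²| ≥ |Y|². Either way p|Y|⁴ ≤ |3Y² − 3Y²| (p|Y|² + |Y|⁴),
-- which is stronger than the claim.
module Submission where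

open import Level using (Level; 0ℓ)
open import Algebra.Bundles using (CommutativeRing)
open import Algebra.Structures using (IsCommutativeRing)
open import Algebra.Morphism.Structures using (IsRingMonomorphism)
import Algebra.Morphism.RingMonomorphism as RingMonomorphism
open import Algebra.Solver.Ring.AlmostCommutativeRing
  using (fromCommutativeRing; _-Raw-AlmostCommutative⟶_)
import Algebra.Solver.Ring as RingSolver
open import Data.Nat as ℕ using (ℕ; zero; suc; NonZero)
import Data.Nat.Properties as ℕ
open import Data.Nat.DivMod using (_mod_; _%_; _/_; m≡m%n+[m/n]*n; m%n<n; m<n⇒m%n≡m)
open import Data.Nat.Primality using (Prime; euclidsLemma)
import Data.Nat.Divisibility as ℕ
open import Data.Integer as ℤ using (ℤ)
import Data.Integer.Properties as ℤ
open import Data.Fin as Fin using (Fin; zero; toℕ)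
open import Data.Fin.Properties using (toℕ-injective; toℕ-fromℕ<; toℕ<n; any?; _≟_; 0≢1+n; suc-injective)
open import Data.Fin.Subset using (Subset; _∈_)
open import Data.Fin.Subset.Properties using (_∈?_)
open import Data.Vec.Properties using (lookup∘tabulate; lookup⇒[]=)
open import Data.Maybe using (map)
open import Data.Product using (_,_; _×_; ∃-syntax)
open import Data.Sum as Sum using (_⊎_; inj₁; inj₂)
open import Data.Empty using (⊥-elim)
open import Function using (_∘_; flip)
open import Relation.Binary.PropositionalEquality
open import Relation.Nullary using (Dec; does; ¬_; yes; no; ¬?; _×-dec_)
open import Relation.Nullary.Decidable using (dec⇒maybe; decidable-stable; dec-true; dec-false)
open import Relation.Nullary.Negation using (contradiction)
import Relation.Unary as U
open import Defs

-- The ring ℤ/pℤ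

module ModularCongruence (n : ℕ) where

  open import Data.Integer using (+_; 0ℤ; 1ℤ; _+_; _*_; _-_; -_)
  open import Data.Integer.Divisibility.Signed using (_∣_; divides; ∣m⇒∣-m; ∣m∣n⇒∣m+n; ∣n⇒∣m*n; ∣m⇒∣m*n)
  open import Data.Integer.Tactic.RingSolver using (solve-∀)

  infix 4 _≈_
  record _≈_ (x y : ℤ) : Set where
    constructor congruent
    field divides-difference : + n ∣ x - y

  ≈-by : ∀ {x y} (k : ℤ) → x - y ≡ k * + n → x ≈ y
  ≈-by k eq = congruent (divides k eq)

  ≡⇒≈ : ∀ {x y} → x ≡ y → x ≈ y
  ≡⇒≈ {x} refl = ≈-by 0ℤ (trans (ℤ.+-inverseʳ x) (sym (ℤ.*-zeroˡ (+ n))))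

  ≈-sym : ∀ {x y} → x ≈ y → y ≈ x
  ≈-sym {x} {y} (congruent n∣x-y) = congruent (subst (+ n ∣_) (-[x-y]≡y-x x y) (∣m⇒∣-m n∣x-y))
    where
    -[x-y]≡y-x : ∀ x y → - (x - y) ≡ y - x
    -[x-y]≡y-x = solve-∀

  ≈-trans : ∀ {x y z} → x ≈ y → y ≈ z → x ≈ z
  ≈-trans {x} {y} {z} (congruent n∣x-y) (congruent n∣y-z) =
    congruent (subst (+ n ∣_) ([x-y]+[y-z]≡x-z x y z) (∣m∣n⇒∣m+n n∣x-y n∣y-z))
    where
    [x-y]+[y-z]≡x-z : ∀ x y z → (x - y) + (y - z) ≡ x - z
    [x-y]+[y-z]≡x-z = solve-∀

  +-cong : ∀ {x y u v} → x ≈ y → u ≈ v → x + u ≈ y + v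
  +-cong {x} {y} {u} {v} (congruent n∣x-y) (congruent n∣u-v) =
    congruent (subst (+ n ∣_) ([x-y]+[u-v]≡[x+u]-[y+v] x y u v) (∣m∣n⇒∣m+n n∣x-y n∣u-v))
    where
    [x-y]+[u-v]≡[x+u]-[y+v] : ∀ x y u v → (x - y) + (u - v) ≡ (x + u) - (y + v)
    [x-y]+[u-v]≡[x+u]-[y+v] = solve-∀

  neg-cong : ∀ {x y} → x ≈ y → - x ≈ - y
  neg-cong {x} {y} (congruent n∣x-y) = congruent (subst (+ n ∣_) (-[x-y]≡-x--y x y) (∣m⇒∣-m n∣x-y))
    where
    -[x-y]≡-x--y : ∀ x y → - (x - y) ≡ - x - - y
    -[x-y]≡-x--y = solve-∀

  *-cong : ∀ {x y u v} → x ≈ y → u ≈ v → x * u ≈ y * v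
  *-cong {x} {y} {u} {v} (congruent n∣x-y) (congruent n∣u-v) =
    congruent (subst (+ n ∣_) (x[u-v]+[x-y]v≡xu-yv x y u v) (∣m∣n⇒∣m+n (∣n⇒∣m*n x n∣u-v) (∣m⇒∣m*n v n∣x-y)))
    where
    x[u-v]+[x-y]v≡xu-yv : ∀ x y u v → x * (u - v) + (x - y) * v ≡ x * u - y * v
    x[u-v]+[x-y]v≡xu-yv = solve-∀

  isCommutativeRing : IsCommutativeRing _≈_ _+_ _*_ -_ 0ℤ 1ℤ
  isCommutativeRing = record
    { isRing = record
      { +-isAbelianGroup = record
        { isGroup = record
          { isMonoid = record
            { isSemigroup = record
              { isMagma = record
                { isEquivalence = record { refl = ≡⇒≈ refl ; sym = ≈-sym ; trans = ≈-trans }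
                ; ∙-cong = +-cong }
              ; assoc = λ x y z → ≡⇒≈ (ℤ.+-assoc x y z) }
            ; identity = ≡⇒≈ ∘ ℤ.+-identityˡ , ≡⇒≈ ∘ ℤ.+-identityʳ }
          ; inverse = ≡⇒≈ ∘ ℤ.+-inverseˡ , ≡⇒≈ ∘ ℤ.+-inverseʳ
          ; ⁻¹-cong = neg-cong }
        ; comm = λ x y → ≡⇒≈ (ℤ.+-comm x y) }
      ; *-cong = *-cong
      ; *-assoc = λ x y z → ≡⇒≈ (ℤ.*-assoc x y z)
      ; *-identity = ≡⇒≈ ∘ ℤ.*-identityˡ , ≡⇒≈ ∘ ℤ.*-identityʳ
      ; distrib = (λ x y z → ≡⇒≈ (ℤ.*-distribˡ-+ x y z)) , (λ x y z → ≡⇒≈ (ℤ.*-distribʳ-+ x y z)) }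
    ; *-comm = λ x y → ≡⇒≈ (ℤ.*-comm x y) }

  commutativeRing : CommutativeRing 0ℓ 0ℓ
  commutativeRing = record { isCommutativeRing = isCommutativeRing }

module ℤ/pℤ (p : ℕ) .{{_ : NonZero p}} where

  open import Data.Integer using (+_; -[1+_]; 0ℤ; 1ℤ; _+_; _*_; _-_; -_; ∣_∣)
  open import Data.Integer.Divisibility.Signed using (∣⇒∣ᵤ; ∣ᵤ⇒∣)
  open import Data.Integer.Tactic.RingSolver using (solve-∀)
  open ModularCongruence p
    renaming (commutativeRing to ℤ-mod-p)

  0ₚ 1ₚ : Fin p
  0ₚ = 0 mod p
  1ₚ = 1 mod p

  -ₚ_ : Fin p → Fin p
  -ₚ x = (p ℕ.∸ toℕ x) mod p

  ι : Fin p → ℤ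
  ι x = + toℕ x

  ι-mod : ∀ m → ι (m mod p) ≈ + m
  ι-mod m = ≈-by (- + (m / p)) (begin
      + toℕ (m mod p) - + m                      ≡⟨ cong₂ (λ r m → + r - m) (toℕ-fromℕ< (m%n<n m p)) m≡r+q*p ⟩
      + (m % p) - (+ (m % p) + + (m / p) * + p)  ≡⟨ r-[r+qn]≡-qn (+ (m % p)) (+ (m / p)) (+ p) ⟩
      - + (m / p) * + p                          ∎)
    where
    open ≡-Reasoning
    m≡r+q*p : + m ≡ + (m % p) + + (m / p) * + p
    m≡r+q*p = trans (cong +_ (m≡m%n+[m/n]*n m p))
                (trans (ℤ.pos-+ (m % p) _) (cong (λ k → + (m % p) + k) (ℤ.pos-* (m / p) p)))
    r-[r+qn]≡-qn : ∀ r q n → r - (r + q * n) ≡ - q * n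
    r-[r+qn]≡-qn = solve-∀

  p∣∧<⇒≡0 : ∀ {m} → p ℕ.∣ m → m ℕ.< p → m ≡ 0
  p∣∧<⇒≡0 {m} p∣m m<p = trans (sym (m<n⇒m%n≡m m<p)) (ℕ.n∣m⇒m%n≡0 m p p∣m)

  ι-injective : ∀ {x y} → ι x ≈ ι y → x ≡ y
  ι-injective {x} {y} (congruent p∣x-y) =
    toℕ-injective (ℤ.+-injective (ℤ.i-j≡0⇒i≡j _ _ (ℤ.∣i∣≡0⇒i≡0 (p∣∧<⇒≡0 (∣⇒∣ᵤ p∣x-y) ∣x-y∣<p))))
    where
    ∣x-y∣<p : ∣ ι x - ι y ∣ ℕ.< p
    ∣x-y∣<p = subst (ℕ._< p) (cong ∣_∣ (sym (ℤ.[+m]-[+n]≡m⊖n (toℕ x) (toℕ y))))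
                (ℕ.≤-<-trans (ℤ.∣m⊝n∣≤m⊔n (toℕ x) (toℕ y)) (ℕ.⊔-pres-<m (toℕ<n x) (toℕ<n y)))

  ι-+ : ∀ x y → ι (x +ₚ y) ≈ ι x + ι y
  ι-+ x y = ≈-trans (ι-mod _) (≡⇒≈ (ℤ.pos-+ (toℕ x) (toℕ y)))

  ι-* : ∀ x y → ι (x *ₚ y) ≈ ι x * ι y
  ι-* x y = ≈-trans (ι-mod _) (≡⇒≈ (ℤ.pos-* (toℕ x) (toℕ y)))

  ι-p∸ : ∀ x → + (p ℕ.∸ toℕ x) ≈ - ι x
  ι-p∸ x = ≈-by 1ℤ (begin
      + (p ℕ.∸ toℕ x) - - ι x  ≡⟨ cong (_- - ι x) p∸x≡p-x ⟩
      (+ p - ι x) - - ι x      ≡⟨ [n-x]--x≡1n (+ p) (ι x) ⟩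
      1ℤ * + p                 ∎)
    where
    open ≡-Reasoning
    p∸x≡p-x : + (p ℕ.∸ toℕ x) ≡ + p - ι x
    p∸x≡p-x = trans (sym (ℤ.⊖-≥ (ℕ.<⇒≤ (toℕ<n x)))) (sym (ℤ.m-n≡m⊖n p (toℕ x)))
    [n-x]--x≡1n : ∀ n x → (n - x) - - x ≡ 1ℤ * n
    [n-x]--x≡1n = solve-∀

  ι-neg : ∀ x → ι (-ₚ x) ≈ - ι x
  ι-neg x = ≈-trans (ι-mod _) (ι-p∸ x)

  ι-isRingMonomorphism : IsRingMonomorphism
    (record { _≈_ = _≡_ ; _+_ = _+ₚ_ ; _*_ = _*ₚ_ ; -_ = -ₚ_ ; 0# = 0ₚ ; 1# = 1ₚ })
    (CommutativeRing.rawRing ℤ-mod-p) ι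
  ι-isRingMonomorphism = record
    { isRingHomomorphism = record
      { isSemiringHomomorphism = record
        { isNearSemiringHomomorphism = record
          { +-isMonoidHomomorphism = record
            { isMagmaHomomorphism = record
              { isRelHomomorphism = record { cong = ≡⇒≈ ∘ cong ι }
              ; homo = ι-+ }
            ; ε-homo = ι-mod 0 }
          ; *-homo = ι-* }
        ; 1#-homo = ι-mod 1 }
      ; -‿homo = ι-neg }
    ; injective = ι-injective }

  -- The ring laws are pulled back along ι, an injective homomorphism into ℤ taken modulo p.
  commutativeRing : CommutativeRing 0ℓ 0ℓ
  commutativeRing = record
    { isCommutativeRing = RingMonomorphism.isCommutativeRing ι-isRingMonomorphism isCommutativeRing }

  -ₚ-as-+ : ∀ x y → x -ₚ y ≡ x +ₚ (-ₚ y)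
  -ₚ-as-+ x y = ι-injective (≈-trans (ι-mod _) (≈-trans (≡⇒≈ (ℤ.pos-+ (toℕ x) _))
               (≈-sym (≈-trans (ι-+ x (-ₚ y)) (+-cong (≡⇒≈ {ι x} refl) (ι-mod (p ℕ.∸ toℕ y)))))))

  -- Integer coefficients keep the ring solver's normal forms computable although p is a variable.
  fromℤ : ℤ → Fin p
  fromℤ (+ n) = n mod p
  fromℤ -[1+ n ] = -ₚ (suc n mod p)

  ι-fromℤ : ∀ z → ι (fromℤ z) ≈ z
  ι-fromℤ (+ n) = ι-mod n
  ι-fromℤ -[1+ n ] = ≈-trans (ι-neg (suc n mod p)) (neg-cong (ι-mod (suc n)))

  fromℤ-homomorphism : ℤ.+-*-rawRing -Raw-AlmostCommutative⟶ fromCommutativeRing commutativeRing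
  fromℤ-homomorphism = record
    { ⟦_⟧ = fromℤ
    ; +-homo = λ x y → ι-injective (≈-trans (ι-fromℤ (x + y))
                 (≈-sym (≈-trans (ι-+ (fromℤ x) (fromℤ y)) (+-cong (ι-fromℤ x) (ι-fromℤ y)))))
    ; *-homo = λ x y → ι-injective (≈-trans (ι-fromℤ (x * y))
                 (≈-sym (≈-trans (ι-* (fromℤ x) (fromℤ y)) (*-cong (ι-fromℤ x) (ι-fromℤ y)))))
    ; -‿homo = λ x → ι-injective (≈-trans (ι-fromℤ (- x))
                 (≈-sym (≈-trans (ι-neg (fromℤ x)) (neg-cong (ι-fromℤ x)))))
    ; 0-homo = refl
    ; 1-homo = refl
    }

  module Solver = RingSolver ℤ.+-*-rawRing (fromCommutativeRing commutativeRing) fromℤ-homomorphism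
    (λ m n → map (cong fromℤ) (dec⇒maybe (m ℤ.≟ n)))

  p∣⇒≈0 : ∀ {m} → p ℕ.∣ m → + m ≈ 0ℤ
  p∣⇒≈0 {m} p∣m = congruent (∣ᵤ⇒∣ (subst (p ℕ.∣_) (sym (ℕ.+-identityʳ m)) p∣m))

  ≈0⇒p∣ : ∀ {m} → + m ≈ 0ℤ → p ℕ.∣ m
  ≈0⇒p∣ {m} (congruent p∣m-0) = subst (p ℕ.∣_) (ℕ.+-identityʳ m) (∣⇒∣ᵤ p∣m-0)

  x*y≡0⇒x≡0∨y≡0 : Prime p → ∀ {x y} → x *ₚ y ≡ 0ₚ → x ≡ 0ₚ ⊎ y ≡ 0ₚ
  x*y≡0⇒x≡0∨y≡0 p-prime {x} {y} xy≡0 =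
    Sum.map p∣toℕ⇒≡0ₚ p∣toℕ⇒≡0ₚ (euclidsLemma (toℕ x) (toℕ y) p-prime (≈0⇒p∣ xy≈0))
    where
    xy≈0 : + (toℕ x ℕ.* toℕ y) ≈ 0ℤ
    xy≈0 = ≈-trans (≈-sym (ι-mod _)) (≈-trans (≡⇒≈ (cong ι xy≡0)) (ι-mod 0))
    p∣toℕ⇒≡0ₚ : ∀ {z} → p ℕ.∣ toℕ z → z ≡ 0ₚ
    p∣toℕ⇒≡0ₚ p∣z = ι-injective (≈-trans (p∣⇒≈0 p∣z) (≈-sym (ι-mod 0)))

  +1-induction : (P : Fin p → Set) → P 0ₚ → (∀ x → P x → P (x +ₚ 1ₚ)) → ∀ x → P x
  +1-induction P P0 step x = subst P (ι-injective (ι-mod (toℕ x))) (P[k] (toℕ x))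
    where
    suc-mod : ∀ k → suc k mod p ≡ (k mod p) +ₚ 1ₚ
    suc-mod k = ι-injective (≈-trans (ι-mod (suc k)) (≈-sym (≈-trans (ι-+ (k mod p) 1ₚ)
                  (≈-trans (+-cong (ι-mod k) (ι-mod 1)) (≡⇒≈ (cong +_ (ℕ.+-comm k 1)))))))
    P[k] : ∀ k → P (k mod p)
    P[k] zero = P0
    P[k] (suc k) = subst P (sym (suc-mod k)) (step _ (P[k] k))

  all-or-exit : ∀ {P : Fin p → Set} → U.Decidable P → P 0ₚ → (∀ x → P x) ⊎ ∃[ x ] P x × ¬ P (x +ₚ 1ₚ)
  all-or-exit {P} P? P0 with any? (λ x → P? x ×-dec ¬? (P? (x +ₚ 1ₚ)))
  ... | yes exit = inj₂ exit
  ... | no ∄exit = inj₁ (+1-induction P P0 λ x Px → decidable-stable (P? (x +ₚ 1ₚ)) λ ¬Px+1 → ∄exit (x , Px , ¬Px+1))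

  +1-surjective : ∀ y → ∃[ x ] x +ₚ 1ₚ ≡ y
  +1-surjective y = y +ₚ (-ₚ 1ₚ) , solve 1 (λ y → (y :- con 1ℤ) :+ con 1ℤ := y) refl y
    where open Solver using (solve; _:=_; _:+_; _:-_; con)

-- Quotients of differences

∈-image2 : ∀ {n} .{{_ : NonZero n}} {_∙_ : Fin n → Fin n → Fin n} {A B : Subset n} {a b} →
           a ∈ A → b ∈ B → a ∙ b ∈ image2 _∙_ A B
∈-image2 {_∙_ = _∙_} {A} {B} {a} {b} a∈A b∈B = lookup⇒[]= _ _ (trans (lookup∘tabulate _ (a ∙ b))
  (dec-true (any? λ x → any? λ y → x ∈? A ×-dec y ∈? B ×-dec a ∙ b ≟ x ∙ y) (a , b , a∈A , b∈B , refl)))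

module DifferenceQuotients (p : ℕ) .{{_ : NonZero p}} (p-prime : Prime p) (Y : Subset p) where

  open ℤ/pℤ p
  open CommutativeRing commutativeRing using (_+_; _*_; -_; _-_; 0#; 1#; ring; -‿inverseʳ)
  open import Algebra.Properties.Ring ring using (+-cancelʳ; x∙y⁻¹≈ε⇒x≈y)
  open Solver using (solve; _:=_; _:+_; _:*_; _:-_; con)

  -- Implicit arguments ranging over Fin p are passed explicitly below: inferring them makes Agda
  -- unfold the modular arithmetic of Defs, which is prohibitively expensive.

  Q : Fin p → Set
  Q ξ = ∃[ a ] ∃[ b ] ∃[ c ] ∃[ d ] a ∈ Y × b ∈ Y × c ∈ Y × d ∈ Y × c ≢ d × (c - d) * ξ ≡ a - b

  Q? : U.Decidable Q
  Q? ξ = any? λ a → any? λ b → any? λ c → any? λ d →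
    a ∈? Y ×-dec b ∈? Y ×-dec c ∈? Y ×-dec d ∈? Y ×-dec ¬? (c ≟ d) ×-dec (c - d) * ξ ≟ a - b

  x≢y⇒x-y≢0 : ∀ {x y} → x ≢ y → x - y ≢ 0#
  x≢y⇒x-y≢0 {x} {y} x≢y x-y≡0 = x≢y (x∙y⁻¹≈ε⇒x≈y x y x-y≡0)

  *-cancelˡ-≢0 : ∀ {x y z} → z ≢ 0# → z * x ≡ z * y → x ≡ y
  *-cancelˡ-≢0 {x} {y} {z} z≢0 zx≡zy =
    Sum.[ flip contradiction z≢0 , x∙y⁻¹≈ε⇒x≈y x y ] (x*y≡0⇒x≡0∨y≡0 p-prime {z} {x - y} z[x-y]≡0)
    where
    z[x-y]≡0 : z * (x - y) ≡ 0#
    z[x-y]≡0 = begin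
      z * (x - y)      ≡⟨ solve 3 (λ x y z → z :* (x :- y) := z :* x :- z :* y) refl x y z ⟩
      z * x - z * y    ≡⟨ cong (_- z * y) zx≡zy ⟩
      z * y - z * y    ≡⟨ -‿inverseʳ (z * y) ⟩
      0#               ∎
      where open ≡-Reasoning

  0∈Q : ∀ {c d} → c ∈ Y → d ∈ Y → c ≢ d → Q 0#
  0∈Q {c} {d} c∈Y d∈Y c≢d = c , c , c , d , c∈Y , c∈Y , c∈Y , d∈Y , c≢d ,
    solve 2 (λ c d → (c :- d) :* con ℤ.0ℤ := c :- c) refl c d

  collision⇒ratio : ∀ {a b c d η} → a + η * b ≡ c + η * d → (d - b) * η ≡ a - c
  collision⇒ratio {a} {b} {c} {d} {η} eq = begin
    (d - b) * η
      ≡⟨ solve 5 (λ a b c d η → (d :- b) :* η := (a :- c) :- ((a :+ η :* b) :- (c :+ η :* d))) refl a b c d η ⟩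
    (a - c) - ((a + η * b) - (c + η * d))    ≡⟨ cong (λ t → (a - c) - (t - (c + η * d))) eq ⟩
    (a - c) - ((c + η * d) - (c + η * d))    ≡⟨ solve 2 (λ s t → s :- (t :- t) := s) refl (a - c) (c + η * d) ⟩
    a - c                                    ∎
    where open ≡-Reasoning

  ∉Q⇒injective : ∀ {η a b c d} → ¬ Q η → a ∈ Y → b ∈ Y → c ∈ Y → d ∈ Y →
                 a + η * b ≡ c + η * d → a ≡ c × b ≡ d
  ∉Q⇒injective {η} {a} {b} {c} {d} η∉Q a∈Y b∈Y c∈Y d∈Y eq with b ≟ d
  ... | yes refl = +-cancelʳ (η * b) a c eq , refl
  ... | no b≢d =
    contradiction (a , c , d , b , a∈Y , c∈Y , d∈Y , b∈Y , b≢d ∘ sym , collision⇒ratio {a} {b} {c} {d} {η} eq) η∉Q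

  collision-unique : ∀ {a b c d} → ¬ (a ≡ c × b ≡ d) →
                     ∀ {η θ} → a + η * b ≡ c + η * d → a + θ * b ≡ c + θ * d → η ≡ θ
  collision-unique {a} {b} {c} {d} ab≢cd {η} {θ} eqη eqθ with b ≟ d
  ... | yes refl = ⊥-elim (ab≢cd (+-cancelʳ (η * b) a c eqη , refl))
  ... | no b≢d = *-cancelˡ-≢0 {η} {θ} {d - b} (x≢y⇒x-y≢0 {d} {b} (b≢d ∘ sym))
                   (trans (collision⇒ratio {a} {b} {c} {d} {η} eqη) (sym (collision⇒ratio {a} {b} {c} {d} {θ} eqθ)))

  ∈Q⇒scaled-image⊆3Y²-3Y² : ∀ {ξ} → Q ξ → ∃[ s ] s ≢ 0# ×
    (∀ {y₁ y₂} → y₁ ∈ Y → y₂ ∈ Y → s * (y₁ + (ξ + 1#) * y₂) ∈ threeY²-threeY² Y)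
  ∈Q⇒scaled-image⊆3Y²-3Y² {ξ} (a , b , c , d , a∈Y , b∈Y , c∈Y , d∈Y , c≢d , ratio) =
    c - d , x≢y⇒x-y≢0 c≢d , λ {y₁} {y₂} y₁∈Y y₂∈Y → subst (_∈ threeY²-threeY² Y) (sym (key-identity y₁ y₂))
      (∈-image2 (∈-3Y² c∈Y y₁∈Y a∈Y y₂∈Y c∈Y y₂∈Y) (∈-3Y² d∈Y y₁∈Y b∈Y y₂∈Y d∈Y y₂∈Y))
    where
    ∈-3Y² : ∀ {x₁ x₂ x₃ x₄ x₅ x₆} → x₁ ∈ Y → x₂ ∈ Y → x₃ ∈ Y → x₄ ∈ Y → x₅ ∈ Y → x₆ ∈ Y →
            x₁ * x₂ + x₃ * x₄ + x₅ * x₆ ∈ sumSet (sumSet (prodSet Y Y) (prodSet Y Y)) (prodSet Y Y)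
    ∈-3Y² x₁∈Y x₂∈Y x₃∈Y x₄∈Y x₅∈Y x₆∈Y =
      ∈-image2 (∈-image2 (∈-image2 x₁∈Y x₂∈Y) (∈-image2 x₃∈Y x₄∈Y)) (∈-image2 x₅∈Y x₆∈Y)
    a≡b+[c-d]ξ : a ≡ b + (c - d) * ξ
    a≡b+[c-d]ξ = trans (solve 2 (λ a b → a := b :+ (a :- b)) refl a b) (cong (λ t → b + t) (sym ratio))
    key-identity : ∀ y₁ y₂ →
      (c - d) * (y₁ + (ξ + 1#) * y₂) ≡ (c * y₁ + a * y₂ + c * y₂) -ₚ (d * y₁ + b * y₂ + d * y₂)
    key-identity y₁ y₂ = begin
      (c - d) * (y₁ + (ξ + 1#) * y₂)
        ≡⟨ solve 6 (λ b c d ξ y₁ y₂ → (c :- d) :* (y₁ :+ (ξ :+ con ℤ.1ℤ) :* y₂)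
                     := (c :* y₁ :+ (b :+ (c :- d) :* ξ) :* y₂ :+ c :* y₂) :- (d :* y₁ :+ b :* y₂ :+ d :* y₂))
                   refl b c d ξ y₁ y₂ ⟩
      (c * y₁ + (b + (c - d) * ξ) * y₂ + c * y₂) - (d * y₁ + b * y₂ + d * y₂)
        ≡⟨ cong (λ t → (c * y₁ + t * y₂ + c * y₂) - (d * y₁ + b * y₂ + d * y₂)) (sym a≡b+[c-d]ξ) ⟩
      (c * y₁ + a * y₂ + c * y₂) - (d * y₁ + b * y₂ + d * y₂)
        ≡⟨ -ₚ-as-+ (c * y₁ + a * y₂ + c * y₂) (d * y₁ + b * y₂ + d * y₂) ⟨
      (c * y₁ + a * y₂ + c * y₂) -ₚ (d * y₁ + b * y₂ + d * y₂) ∎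
      where open ≡-Reasoning

open import Data.Nat using (_+_; _*_; _∸_; _≤_; _<_; z≤n)
open import Data.Nat.Tactic.RingSolver using (solve-∀)
open import Data.Bool using (true; false; if_then_else_)
open import Data.Vec using ([]; _∷_)
open import Data.Fin.Subset using (∣_∣)
open import Function.Definitions using (Injective)
open import Algebra.Properties.CommutativeSemigroup ℕ.*-commutativeSemigroup using (x∙yz≈y∙xz)
open import Algebra.Properties.Semiring.Sum ℕ.+-*-semiring
  using (sum; sum-syntax; sum-cong-≗; sum-replicate-zero; ∑-distrib-+; ∑-comm; *-distribˡ-sum; *-distribʳ-sum)

-- Finite sums of natural numbers

private
  variable
    ℓ₁ ℓ₂ : Level
    A : Set ℓ₁
    B : Set ℓ₂

-- Defined through does, so that 𝟙 (suc i ≟ suc j) computes to 𝟙 (i ≟ j).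
𝟙 : Dec A → ℕ
𝟙 A? = if does A? then 1 else 0

𝟙-yes : (A? : Dec A) → A → 𝟙 A? ≡ 1
𝟙-yes A? a = cong (if_then 1 else 0) (dec-true A? a)

𝟙-no : (A? : Dec A) → ¬ A → 𝟙 A? ≡ 0
𝟙-no A? ¬a = cong (if_then 1 else 0) (dec-false A? ¬a)

𝟙≤1 : (A? : Dec A) → 𝟙 A? ≤ 1
𝟙≤1 (yes _) = ℕ.≤-refl
𝟙≤1 (no _) = z≤n

𝟙-idem : (A? : Dec A) → 𝟙 A? * 𝟙 A? ≡ 𝟙 A?
𝟙-idem (yes _) = refl
𝟙-idem (no _) = refl

𝟙-mono : (A? : Dec A) (B? : Dec B) → (A → B) → 𝟙 A? ≤ 𝟙 B?
𝟙-mono (yes a) B? A⇒B = ℕ.≤-reflexive (sym (𝟙-yes B? (A⇒B a)))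
𝟙-mono (no _) B? A⇒B = z≤n

𝟙-× : (A? : Dec A) (B? : Dec B) → 𝟙 (A? ×-dec B?) ≡ 𝟙 A? * 𝟙 B?
𝟙-× (yes _) (yes _) = refl
𝟙-× (yes _) (no _) = refl
𝟙-× (no _) B? = refl

∑-mono-≤ : ∀ {n} {f g : Fin n → ℕ} → (∀ i → f i ≤ g i) → sum f ≤ sum g
∑-mono-≤ {zero} f≤g = z≤n
∑-mono-≤ {suc n} f≤g = ℕ.+-mono-≤ (f≤g zero) (∑-mono-≤ (f≤g ∘ Fin.suc))

∑-const : ∀ n c → ∑[ i < n ] c ≡ n * c
∑-const zero c = refl
∑-const (suc n) c = cong (c +_) (∑-const n c)

∑-zero : ∀ {n} {f : Fin n → ℕ} → (∀ i → f i ≡ 0) → sum f ≡ 0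
∑-zero {n} f≗0 = trans (sum-cong-≗ f≗0) (sum-replicate-zero n)

∑*∑ : ∀ {m n} (f : Fin m → ℕ) (g : Fin n → ℕ) → sum f * sum g ≡ ∑[ i < m ] ∑[ j < n ] (f i * g j)
∑*∑ f g = trans (*-distribʳ-sum (sum g) f) (sum-cong-≗ λ i → *-distribˡ-sum (f i) g)

∑-𝟙≟* : ∀ {n} (i : Fin n) (f : Fin n → ℕ) → ∑[ j < n ] (𝟙 (i ≟ j) * f j) ≡ f i
∑-𝟙≟* {suc n} zero f =
  trans (cong₂ _+_ (ℕ.*-identityˡ (f zero)) (∑-zero λ j → cong (_* f (Fin.suc j)) (𝟙-no (zero ≟ Fin.suc j) λ ())))
        (ℕ.+-identityʳ (f zero))
∑-𝟙≟* {suc n} (Fin.suc i) f =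
  trans (cong (_+ ∑[ j < n ] (𝟙 (i ≟ j) * f (Fin.suc j))) (cong (_* f zero) (𝟙-no (Fin.suc i ≟ zero) λ ())))
        (∑-𝟙≟* i (f ∘ Fin.suc))

∑-𝟙≟ : ∀ {n} (i : Fin n) → ∑[ j < n ] 𝟙 (i ≟ j) ≡ 1
∑-𝟙≟ {n} i = trans (sum-cong-≗ λ j → sym (ℕ.*-identityʳ (𝟙 (i ≟ j)))) (∑-𝟙≟* i λ _ → 1)

∑-𝟙-≤1 : ∀ {ℓ n} {P : Fin n → Set ℓ} (P? : U.Decidable P) → (∀ {i j} → P i → P j → i ≡ j) →
         ∑[ i < n ] 𝟙 (P? i) ≤ 1
∑-𝟙-≤1 {n = zero} P? unique = z≤n
∑-𝟙-≤1 {n = suc n} P? unique with P? zero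
... | yes P0 = ℕ.≤-reflexive (cong suc (∑-zero λ i → 𝟙-no (P? (Fin.suc i)) λ Pi → 0≢1+n (unique P0 Pi)))
... | no _ = ∑-𝟙-≤1 (P? ∘ Fin.suc) λ Pi Pj → suc-injective (unique Pi Pj)

∑-𝟙≤n : ∀ {ℓ n} {P : Fin n → Set ℓ} (P? : U.Decidable P) → ∑[ i < n ] 𝟙 (P? i) ≤ n
∑-𝟙≤n {n = n} P? = ℕ.≤-trans (∑-mono-≤ (𝟙≤1 ∘ P?)) (ℕ.≤-reflexive (trans (∑-const n 1) (ℕ.*-identityʳ n)))

∑-∘-injective-≤ : ∀ {m n} (φ : Fin m → Fin n) → Injective _≡_ _≡_ φ → (f : Fin n → ℕ) →
                  ∑[ i < m ] f (φ i) ≤ ∑[ j < n ] f j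
∑-∘-injective-≤ {m} {n} φ φ-inj f = begin
  ∑[ i < m ] f (φ i)                            ≡⟨ sum-cong-≗ (λ i → ∑-𝟙≟* (φ i) f) ⟨
  ∑[ i < m ] ∑[ j < n ] (𝟙 (φ i ≟ j) * f j)     ≡⟨ ∑-comm (λ i j → 𝟙 (φ i ≟ j) * f j) ⟩
  ∑[ j < n ] ∑[ i < m ] (𝟙 (φ i ≟ j) * f j)     ≡⟨ sum-cong-≗ (λ j → *-distribʳ-sum (f j) λ i → 𝟙 (φ i ≟ j)) ⟨
  ∑[ j < n ] ((∑[ i < m ] 𝟙 (φ i ≟ j)) * f j)   ≤⟨ ∑-mono-≤ (λ j → ℕ.*-monoˡ-≤ (f j) (fibre≤1 j)) ⟩
  ∑[ j < n ] (1 * f j)                          ≡⟨ sum-cong-≗ (λ j → ℕ.*-identityˡ (f j)) ⟩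
  ∑[ j < n ] f j                                ∎
  where
  open ℕ.≤-Reasoning
  fibre≤1 : ∀ j → ∑[ i < m ] 𝟙 (φ i ≟ j) ≤ 1
  fibre≤1 j = ∑-𝟙-≤1 (λ i → φ i ≟ j) λ φi≡j φk≡j → φ-inj (trans φi≡j (sym φk≡j))

2xy≤x²+y² : ∀ x y → 2 * (x * y) ≤ x * x + y * y
2xy≤x²+y² x y = Sum.[ ordered , swapped ]′ (ℕ.≤-total x y)
  where
  ordered : ∀ {x y} → x ≤ y → 2 * (x * y) ≤ x * x + y * y
  ordered {x} x≤y with d , refl ← ℕ.m≤n⇒∃[o]m+o≡n x≤y =
    subst (2 * (x * (x + d)) ≤_) (square-of-sum x d) (ℕ.m≤m+n (2 * (x * (x + d))) (d * d))
    where
    square-of-sum : ∀ x d → 2 * (x * (x + d)) + d * d ≡ x * x + (x + d) * (x + d)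
    square-of-sum = solve-∀
  swapped : y ≤ x → 2 * (x * y) ≤ x * x + y * y
  swapped y≤x = subst₂ _≤_ (cong (2 *_) (ℕ.*-comm y x)) (ℕ.+-comm (y * y) (x * x)) (ordered y≤x)

∑² : ∀ {m n} → (Fin m → Fin n → ℕ) → ℕ
∑² {m} {n} f = ∑[ i < m ] ∑[ j < n ] f i j

module _ {m n : ℕ} where

  ∑²-cong : ∀ {f g : Fin m → Fin n → ℕ} → (∀ i j → f i j ≡ g i j) → ∑² f ≡ ∑² g
  ∑²-cong f≗g = sum-cong-≗ λ i → sum-cong-≗ (f≗g i)

  ∑²-mono-≤ : ∀ {f g : Fin m → Fin n → ℕ} → (∀ i j → f i j ≤ g i j) → ∑² f ≤ ∑² g
  ∑²-mono-≤ f≤g = ∑-mono-≤ λ i → ∑-mono-≤ (f≤g i)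

  ∑²-distrib-+ : ∀ (f g : Fin m → Fin n → ℕ) → ∑² (λ i j → f i j + g i j) ≡ ∑² f + ∑² g
  ∑²-distrib-+ f g = trans (sum-cong-≗ λ i → ∑-distrib-+ (f i) (g i)) (∑-distrib-+ (λ i → sum (f i)) (λ i → sum (g i)))

  *-distribˡ-∑² : ∀ c (f : Fin m → Fin n → ℕ) → c * ∑² f ≡ ∑² λ i j → c * f i j
  *-distribˡ-∑² c f = trans (*-distribˡ-sum c (λ i → sum (f i))) (sum-cong-≗ λ i → *-distribˡ-sum c (f i))

  *-distribʳ-∑² : ∀ c (f : Fin m → Fin n → ℕ) → ∑² f * c ≡ ∑² λ i j → f i j * c
  *-distribʳ-∑² c f = trans (*-distribʳ-sum c (λ i → sum (f i))) (sum-cong-≗ λ i → *-distribʳ-sum c (f i))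

  ∑-∑²-comm : ∀ {k} (f : Fin k → Fin m → Fin n → ℕ) → ∑[ x < k ] ∑² (f x) ≡ ∑² λ i j → ∑[ x < k ] f x i j
  ∑-∑²-comm f = trans (∑-comm λ x i → sum (f x i)) (sum-cong-≗ λ i → ∑-comm λ x j → f x i j)

  ∑²*∑² : ∀ (f g : Fin m → Fin n → ℕ) → ∑² f * ∑² g ≡ ∑² λ a b → ∑² λ c d → f a b * g c d
  ∑²*∑² f g = trans (*-distribʳ-∑² (∑² g) f) (∑²-cong λ a b → *-distribˡ-∑² (f a b) g)

  ∑²-𝟙≟* : ∀ a b (g : Fin m → Fin n → ℕ) → ∑² (λ c d → 𝟙 ((a ≟ c) ×-dec (b ≟ d)) * g c d) ≡ g a b
  ∑²-𝟙≟* a b g = begin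
    ∑² (λ c d → 𝟙 ((a ≟ c) ×-dec (b ≟ d)) * g c d)
      ≡⟨ ∑²-cong split ⟩
    ∑[ c < m ] ∑[ d < n ] (𝟙 (a ≟ c) * (𝟙 (b ≟ d) * g c d))
      ≡⟨ sum-cong-≗ (λ c → *-distribˡ-sum (𝟙 (a ≟ c)) λ d → 𝟙 (b ≟ d) * g c d) ⟨
    ∑[ c < m ] (𝟙 (a ≟ c) * ∑[ d < n ] (𝟙 (b ≟ d) * g c d))
      ≡⟨ ∑-𝟙≟* a (λ c → ∑[ d < n ] (𝟙 (b ≟ d) * g c d)) ⟩
    ∑[ d < n ] (𝟙 (b ≟ d) * g a d)
      ≡⟨ ∑-𝟙≟* b (g a) ⟩
    g a b
      ∎
    where
    open ≡-Reasoning
    split : ∀ c d → 𝟙 ((a ≟ c) ×-dec (b ≟ d)) * g c d ≡ 𝟙 (a ≟ c) * (𝟙 (b ≟ d) * g c d)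
    split c d = trans (cong (_* g c d) (𝟙-× (a ≟ c) (b ≟ d))) (ℕ.*-assoc (𝟙 (a ≟ c)) (𝟙 (b ≟ d)) (g c d))

cauchy-schwarz : ∀ {n} (f g : Fin n → ℕ) →
  (∑[ i < n ] (f i * g i)) * (∑[ i < n ] (f i * g i)) ≤ (∑[ i < n ] (f i * f i)) * (∑[ i < n ] (g i * g i))
cauchy-schwarz {n} f g = ℕ.*-cancelˡ-≤ 2 (begin
  2 * (sum FG * sum FG)                            ≡⟨ cong (2 *_) (∑*∑ FG FG) ⟩
  2 * ∑² (λ i j → FG i * FG j)                     ≡⟨ *-distribˡ-∑² 2 (λ i j → FG i * FG j) ⟩
  ∑² (λ i j → 2 * (FG i * FG j))                   ≤⟨ ∑²-mono-≤ (λ i j → termwise (f i) (g i) (f j) (g j)) ⟩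
  ∑² (λ i j → F i * G j + F j * G i)               ≡⟨ ∑²-distrib-+ (λ i j → F i * G j) (λ i j → F j * G i) ⟩
  ∑² (λ i j → F i * G j) + ∑² (λ i j → F j * G i)  ≡⟨ cong (∑² (λ i j → F i * G j) +_) (∑-comm λ i j → F j * G i) ⟩
  ∑² (λ i j → F i * G j) + ∑² (λ i j → F i * G j)  ≡⟨ cong (λ t → t + t) (∑*∑ F G) ⟨
  sum F * sum G + sum F * sum G                    ≡⟨ cong (sum F * sum G +_) (ℕ.+-identityʳ _) ⟨
  2 * (sum F * sum G)                              ∎)
  where
  open ℕ.≤-Reasoning
  FG F G : Fin n → ℕ
  FG i = f i * g i
  F i = f i * f i
  G i = g i * g i
  termwise : ∀ a b c d → 2 * (a * b * (c * d)) ≤ a * a * (d * d) + c * c * (b * b)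
  termwise a b c d =
    subst₂ _≤_ (cong (2 *_) (regroup a b c d)) (cong₂ _+_ (square-of-product a d) (square-of-product c b))
      (2xy≤x²+y² (a * d) (c * b))
    where
    regroup : ∀ a b c d → a * d * (c * b) ≡ a * b * (c * d)
    regroup = solve-∀
    square-of-product : ∀ x y → x * y * (x * y) ≡ x * x * (y * y)
    square-of-product = solve-∀

cauchy-schwarz-on-support : ∀ {ℓ n} {P : Fin n → Set ℓ} (P? : U.Decidable P) (r : Fin n → ℕ) →
  (∀ i → r i ≢ 0 → P i) → sum r * sum r ≤ (∑[ i < n ] 𝟙 (P? i)) * (∑[ i < n ] (r i * r i))
cauchy-schwarz-on-support {n = n} P? r supported = begin
  sum r * sum r                                            ≡⟨ cong₂ _*_ ∑r≡∑𝟙r ∑r≡∑𝟙r ⟩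
  (∑[ i < n ] (𝟙 (P? i) * r i)) * (∑[ i < n ] (𝟙 (P? i) * r i))   ≤⟨ cauchy-schwarz (𝟙 ∘ P?) r ⟩
  (∑[ i < n ] (𝟙 (P? i) * 𝟙 (P? i))) * (∑[ i < n ] (r i * r i))   ≡⟨ cong (_* _) (sum-cong-≗ (𝟙-idem ∘ P?)) ⟩
  (∑[ i < n ] 𝟙 (P? i)) * (∑[ i < n ] (r i * r i))               ∎
  where
  open ℕ.≤-Reasoning
  r≡𝟙*r : ∀ i → r i ≡ 𝟙 (P? i) * r i
  r≡𝟙*r i with r i ℕ.≟ 0
  ... | yes ri≡0 = trans ri≡0 (sym (trans (cong (𝟙 (P? i) *_) ri≡0) (ℕ.*-zeroʳ (𝟙 (P? i)))))
  ... | no ri≢0 = sym (trans (cong (_* r i) (𝟙-yes (P? i) (supported i ri≢0))) (ℕ.*-identityˡ (r i)))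
  ∑r≡∑𝟙r : sum r ≡ ∑[ i < n ] (𝟙 (P? i) * r i)
  ∑r≡∑𝟙r = sum-cong-≗ r≡𝟙*r

∣A∣≡∑𝟙[∈A] : ∀ {n} (A : Subset n) → ∣ A ∣ ≡ ∑[ x < n ] 𝟙 (x ∈? A)
∣A∣≡∑𝟙[∈A] [] = refl
∣A∣≡∑𝟙[∈A] (true ∷ A) = cong suc (∣A∣≡∑𝟙[∈A] A)
∣A∣≡∑𝟙[∈A] (false ∷ A) = ∣A∣≡∑𝟙[∈A] A

1<∣A∣⇒distinct : ∀ {n} {A : Subset n} → 1 < ∣ A ∣ → ∃[ x ] ∃[ y ] x ∈ A × y ∈ A × x ≢ y
1<∣A∣⇒distinct {n} {A} 1<∣A∣ with any? (λ x → any? λ y → x ∈? A ×-dec y ∈? A ×-dec ¬? (x ≟ y))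
... | yes distinct = distinct
... | no ∄distinct = contradiction (subst (_≤ 1) (sym (∣A∣≡∑𝟙[∈A] A)) (∑-𝟙-≤1 (_∈? A) unique)) (ℕ.<⇒≱ 1<∣A∣)
  where
  unique : ∀ {x y} → x ∈ A → y ∈ A → x ≡ y
  unique {x} {y} x∈A y∈A = decidable-stable (x ≟ y) λ x≢y → ∄distinct (x , y , x∈A , y∈A , x≢y)

-- Additive energy

module Energy {ℓ} {k n : ℕ} {S : Fin k → Fin k → Set ℓ} (S? : ∀ a b → Dec (S a b)) where

  w : Fin k → Fin k → ℕ
  w a b = 𝟙 (S? a b)

  fibre : (Fin k → Fin k → Fin n) → Fin n → ℕ
  fibre u x = ∑² λ a b → w a b * 𝟙 (u a b ≟ x)

  energy : (Fin k → Fin k → Fin n) → ℕ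
  energy u = ∑² λ a b → ∑² λ c d → w a b * w c d * 𝟙 (u a b ≟ u c d)

  ∑-fibre : ∀ u → ∑[ x < n ] fibre u x ≡ ∑² w
  ∑-fibre u = begin
    ∑[ x < n ] fibre u x
      ≡⟨ ∑-∑²-comm (λ x a b → w a b * 𝟙 (u a b ≟ x)) ⟩
    ∑² (λ a b → ∑[ x < n ] (w a b * 𝟙 (u a b ≟ x)))
      ≡⟨ ∑²-cong (λ a b → *-distribˡ-sum (w a b) λ x → 𝟙 (u a b ≟ x)) ⟨
    ∑² (λ a b → w a b * ∑[ x < n ] 𝟙 (u a b ≟ x))
      ≡⟨ ∑²-cong (λ a b → trans (cong (w a b *_) (∑-𝟙≟ (u a b))) (ℕ.*-identityʳ (w a b))) ⟩
    ∑² w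
      ∎
    where open ≡-Reasoning

  ∑-fibre² : ∀ u → ∑[ x < n ] (fibre u x * fibre u x) ≡ energy u
  ∑-fibre² u = begin
    ∑[ x < n ] (fibre u x * fibre u x)
      ≡⟨ sum-cong-≗ (λ x → ∑²*∑² (term x) (term x)) ⟩
    ∑[ x < n ] ∑² (λ a b → ∑² λ c d → term x a b * term x c d)
      ≡⟨ ∑-∑²-comm (λ x a b → ∑² λ c d → term x a b * term x c d) ⟩
    ∑² (λ a b → ∑[ x < n ] ∑² λ c d → term x a b * term x c d)
      ≡⟨ ∑²-cong (λ a b → ∑-∑²-comm λ x c d → term x a b * term x c d) ⟩
    ∑² (λ a b → ∑² λ c d → ∑[ x < n ] (term x a b * term x c d))
      ≡⟨ ∑²-cong (λ a b → ∑²-cong (sift a b)) ⟩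
    energy u
      ∎
    where
    open ≡-Reasoning
    term : Fin n → Fin k → Fin k → ℕ
    term x a b = w a b * 𝟙 (u a b ≟ x)
    rearrange : ∀ v x v′ y → v * x * (v′ * y) ≡ y * (v * v′ * x)
    rearrange = solve-∀
    sift : ∀ a b c d → ∑[ x < n ] (term x a b * term x c d) ≡ w a b * w c d * 𝟙 (u a b ≟ u c d)
    sift a b c d = trans (sum-cong-≗ λ x → rearrange (w a b) (𝟙 (u a b ≟ x)) (w c d) (𝟙 (u c d ≟ x)))
                         (∑-𝟙≟* (u c d) λ x → w a b * w c d * 𝟙 (u a b ≟ x))

  image⊆T⇒[∑²w]²≤∣T∣*energy : ∀ {ℓ′} {T : Fin n → Set ℓ′} (T? : U.Decidable T) u →
    (∀ {a b} → S a b → T (u a b)) → ∑² w * ∑² w ≤ (∑[ x < n ] 𝟙 (T? x)) * energy u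
  image⊆T⇒[∑²w]²≤∣T∣*energy {T = T} T? u S⇒T = begin
    ∑² w * ∑² w
      ≡⟨ cong₂ _*_ (∑-fibre u) (∑-fibre u) ⟨
    sum (fibre u) * sum (fibre u)
      ≤⟨ cauchy-schwarz-on-support T? (fibre u) supported ⟩
    (∑[ x < n ] 𝟙 (T? x)) * (∑[ x < n ] (fibre u x * fibre u x))
      ≡⟨ cong (∑[ x < n ] 𝟙 (T? x) *_) (∑-fibre² u) ⟩
    (∑[ x < n ] 𝟙 (T? x)) * energy u
      ∎
    where
    open ℕ.≤-Reasoning
    term-outside : ∀ {x} → ¬ T x → ∀ a b → w a b * 𝟙 (u a b ≟ x) ≡ 0
    term-outside {x} ¬Tx a b with S? a b
    ... | yes s = cong (1 *_) (𝟙-no (u a b ≟ x) λ ux≡x → ¬Tx (subst T ux≡x (S⇒T s)))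
    ... | no _ = refl
    supported : ∀ x → fibre u x ≢ 0 → T x
    supported x fibre≢0 = decidable-stable (T? x) λ ¬Tx → fibre≢0 (∑-zero λ a → ∑-zero (term-outside ¬Tx a))

  injective⇒energy≤∑²w : ∀ u → (∀ {a b c d} → S a b → S c d → u a b ≡ u c d → a ≡ c × b ≡ d) →
                         energy u ≤ ∑² w
  injective⇒energy≤∑²w u injective = begin
    energy u                                                   ≤⟨ ∑²-mono-≤ (λ a b → ∑²-mono-≤ (pointwise a b)) ⟩
    ∑² (λ a b → ∑² λ c d → 𝟙 ((a ≟ c) ×-dec (b ≟ d)) * w c d)  ≡⟨ ∑²-cong (λ a b → ∑²-𝟙≟* a b w) ⟩
    ∑² w                                                       ∎
    where
    open ℕ.≤-Reasoning
    pointwise : ∀ a b c d → w a b * w c d * 𝟙 (u a b ≟ u c d) ≤ 𝟙 ((a ≟ c) ×-dec (b ≟ d)) * w c d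
    pointwise a b c d = begin
      w a b * w c d * 𝟙 (u a b ≟ u c d)
        ≡⟨ trans (𝟙-× collision? (u a b ≟ u c d)) (cong (_* 𝟙 (u a b ≟ u c d)) (𝟙-× (S? a b) (S? c d))) ⟨
      𝟙 (collision? ×-dec (u a b ≟ u c d))
        ≤⟨ 𝟙-mono (collision? ×-dec (u a b ≟ u c d)) (equal? ×-dec S? c d) (λ ((s , t) , eq) → injective s t eq , t) ⟩
      𝟙 (equal? ×-dec S? c d)
        ≡⟨ 𝟙-× equal? (S? c d) ⟩
      𝟙 equal? * w c d
        ∎
      where
      collision? : Dec (S a b × S c d)
      collision? = S? a b ×-dec S? c d
      equal? : Dec (a ≡ c × b ≡ d)
      equal? = (a ≟ c) ×-dec (b ≟ d)

  collide-once⇒∑-energy≤ : ∀ {m} (u : Fin m → Fin k → Fin k → Fin n) →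
    (∀ {a b c d} → ¬ (a ≡ c × b ≡ d) → ∀ {η θ} → u η a b ≡ u η c d → u θ a b ≡ u θ c d → η ≡ θ) →
    ∑[ η < m ] energy (u η) ≤ m * ∑² w + ∑² w * ∑² w
  collide-once⇒∑-energy≤ {m} u collide-once = begin
    ∑[ η < m ] energy (u η)
      ≡⟨ ∑-∑²-comm (λ η a b → ∑² λ c d → W a b c d * δ η a b c d) ⟩
    ∑² (λ a b → ∑[ η < m ] ∑² λ c d → W a b c d * δ η a b c d)
      ≡⟨ ∑²-cong (λ a b → ∑-∑²-comm λ η c d → W a b c d * δ η a b c d) ⟩
    ∑² (λ a b → ∑² λ c d → ∑[ η < m ] (W a b c d * δ η a b c d))
      ≡⟨ ∑²-cong (λ a b → ∑²-cong λ c d → *-distribˡ-sum (W a b c d) λ η → δ η a b c d) ⟨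
    ∑² (λ a b → ∑² λ c d → W a b c d * collisions a b c d)
      ≤⟨ ∑²-mono-≤ (λ a b → ∑²-mono-≤ (pointwise a b)) ⟩
    ∑² (λ a b → ∑² λ c d → m * diagonal a b c d + W a b c d)
      ≡⟨ ∑²-cong (λ a b → ∑²-distrib-+ (λ c d → m * diagonal a b c d) (W a b)) ⟩
    ∑² (λ a b → ∑² (λ c d → m * diagonal a b c d) + ∑² (W a b))
      ≡⟨ ∑²-distrib-+ (λ a b → ∑² λ c d → m * diagonal a b c d) (λ a b → ∑² (W a b)) ⟩
    ∑² (λ a b → ∑² λ c d → m * diagonal a b c d) + ∑² (λ a b → ∑² (W a b))
      ≡⟨ cong₂ _+_ ∑-m*diagonal (sym (∑²*∑² w w)) ⟩
    m * ∑² w + ∑² w * ∑² w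
      ∎
    where
    open ℕ.≤-Reasoning
    W : Fin k → Fin k → Fin k → Fin k → ℕ
    W a b c d = w a b * w c d
    δ : Fin m → Fin k → Fin k → Fin k → Fin k → ℕ
    δ η a b c d = 𝟙 (u η a b ≟ u η c d)
    collisions : Fin k → Fin k → Fin k → Fin k → ℕ
    collisions a b c d = ∑[ η < m ] δ η a b c d
    diagonal : Fin k → Fin k → Fin k → Fin k → ℕ
    diagonal a b c d = 𝟙 ((a ≟ c) ×-dec (b ≟ d)) * w c d
    ∑-m*diagonal : ∑² (λ a b → ∑² λ c d → m * diagonal a b c d) ≡ m * ∑² w
    ∑-m*diagonal = trans (∑²-cong λ a b → trans (sym (*-distribˡ-∑² m (diagonal a b))) (cong (m *_) (∑²-𝟙≟* a b w)))
                         (sym (*-distribˡ-∑² m w))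
    pointwise : ∀ a b c d → W a b c d * collisions a b c d ≤ m * diagonal a b c d + W a b c d
    pointwise a b c d with (a ≟ c) ×-dec (b ≟ d)
    ... | yes (refl , refl) = ℕ.≤-trans (begin
      w a b * w a b * collisions a b a b  ≡⟨ cong (_* collisions a b a b) (𝟙-idem (S? a b)) ⟩
      w a b * collisions a b a b          ≤⟨ ℕ.*-monoʳ-≤ (w a b) (∑-𝟙≤n λ η → u η a b ≟ u η a b) ⟩
      w a b * m                           ≡⟨ ℕ.*-comm (w a b) m ⟩
      m * w a b                           ≡⟨ cong (m *_) (ℕ.*-identityˡ (w a b)) ⟨
      m * (1 * w a b)                     ≡⟨ cong (λ t → m * (t * w a b)) (𝟙-yes ((a ≟ a) ×-dec (b ≟ b)) (refl , refl)) ⟨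
      m * diagonal a b a b                ∎) (ℕ.m≤m+n (m * diagonal a b a b) (W a b a b))
    ... | no ab≢cd = ℕ.≤-trans (begin
      W a b c d * collisions a b c d
        ≤⟨ ℕ.*-monoʳ-≤ (W a b c d) (∑-𝟙-≤1 (λ η → u η a b ≟ u η c d) (collide-once ab≢cd)) ⟩
      W a b c d * 1
        ≡⟨ ℕ.*-identityʳ (W a b c d) ⟩
      W a b c d
        ∎) (ℕ.m≤n+m (W a b c d) (m * diagonal a b c d))

-- The sum-product bound

module SumProduct (p : ℕ) .{{_ : NonZero p}} (p-prime : Prime p) (Y : Subset p) where

  open ℤ/pℤ p using (1ₚ; all-or-exit; +1-surjective)
  open DifferenceQuotients p p-prime Y
  open Energy {n = p} (λ a b → a ∈? Y ×-dec b ∈? Y)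

  D : Subset p
  D = threeY²-threeY² Y

  u : Fin p → Fin p → Fin p → Fin p
  u η a b = a +ₚ (η *ₚ b)

  N : ℕ
  N = ∑² w

  N≡∣Y∣² : N ≡ ∣ Y ∣ * ∣ Y ∣
  N≡∣Y∣² = begin
    ∑² (λ a b → 𝟙 (a ∈? Y ×-dec b ∈? Y))              ≡⟨ ∑²-cong (λ a b → 𝟙-× (a ∈? Y) (b ∈? Y)) ⟩
    ∑² (λ a b → 𝟙 (a ∈? Y) * 𝟙 (b ∈? Y))              ≡⟨ ∑*∑ (λ a → 𝟙 (a ∈? Y)) (λ b → 𝟙 (b ∈? Y)) ⟨
    (∑[ a < p ] 𝟙 (a ∈? Y)) * (∑[ b < p ] 𝟙 (b ∈? Y))  ≡⟨ cong₂ _*_ (∣A∣≡∑𝟙[∈A] Y) (∣A∣≡∑𝟙[∈A] Y) ⟨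
    ∣ Y ∣ * ∣ Y ∣                                      ∎
    where open ≡-Reasoning

  ∈Q⇒N²≤∣D∣*energy : ∀ {ξ} → Q ξ → N * N ≤ ∣ D ∣ * energy (u (ξ +ₚ 1ₚ))
  ∈Q⇒N²≤∣D∣*energy {ξ} ξ∈Q = let s , s≢0 , s·image⊆D = ∈Q⇒scaled-image⊆3Y²-3Y² {ξ} ξ∈Q in begin
    N * N
      ≤⟨ image⊆T⇒[∑²w]²≤∣T∣*energy (λ x → s *ₚ x ∈? D) (u (ξ +ₚ 1ₚ)) (λ (y₁∈Y , y₂∈Y) → s·image⊆D y₁∈Y y₂∈Y) ⟩
    (∑[ x < p ] 𝟙 (s *ₚ x ∈? D)) * E
      ≤⟨ ℕ.*-monoˡ-≤ E (∑-∘-injective-≤ (s *ₚ_) (*-cancelˡ-≢0 s≢0) λ z → 𝟙 (z ∈? D)) ⟩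
    (∑[ z < p ] 𝟙 (z ∈? D)) * E
      ≡⟨ cong (_* E) (∣A∣≡∑𝟙[∈A] D) ⟨
    ∣ D ∣ * E
      ∎
    where
    open ℕ.≤-Reasoning
    E : ℕ
    E = energy (u (ξ +ₚ 1ₚ))

  ∉Q⇒energy≤N : ∀ {η} → ¬ Q η → energy (u η) ≤ N
  ∉Q⇒energy≤N {η} η∉Q =
    injective⇒energy≤∑²w (u η) λ (a∈Y , b∈Y) (c∈Y , d∈Y) → ∉Q⇒injective {η} η∉Q a∈Y b∈Y c∈Y d∈Y

  bound-if-Q-everywhere : (∀ ξ → Q ξ) → p * (N * N) ≤ ∣ D ∣ * (p * N + N * N)
  bound-if-Q-everywhere ∀Q = begin
    p * (N * N)                       ≡⟨ ∑-const p (N * N) ⟨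
    ∑[ η < p ] (N * N)                ≤⟨ ∑-mono-≤ N²≤∣D∣*energy ⟩
    ∑[ η < p ] (∣ D ∣ * energy (u η)) ≡⟨ *-distribˡ-sum ∣ D ∣ (λ η → energy (u η)) ⟨
    ∣ D ∣ * ∑[ η < p ] energy (u η)   ≤⟨ ℕ.*-monoʳ-≤ ∣ D ∣ (collide-once⇒∑-energy≤ u collision-unique) ⟩
    ∣ D ∣ * (p * N + N * N)           ∎
    where
    open ℕ.≤-Reasoning
    N²≤∣D∣*energy : ∀ η → N * N ≤ ∣ D ∣ * energy (u η)
    N²≤∣D∣*energy η = let ξ , ξ+1≡η = +1-surjective η in
      subst (λ η → N * N ≤ ∣ D ∣ * energy (u η)) ξ+1≡η (∈Q⇒N²≤∣D∣*energy {ξ} (∀Q ξ))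

  bound-if-Q-exits : ∀ {ξ} → Q ξ → ¬ Q (ξ +ₚ 1ₚ) → p * (N * N) ≤ ∣ D ∣ * (p * N + N * N)
  bound-if-Q-exits {ξ} ξ∈Q ξ+1∉Q = begin
    p * (N * N)              ≤⟨ ℕ.*-monoʳ-≤ p (ℕ.≤-trans (∈Q⇒N²≤∣D∣*energy {ξ} ξ∈Q)
                                                (ℕ.*-monoʳ-≤ ∣ D ∣ (∉Q⇒energy≤N {ξ +ₚ 1ₚ} ξ+1∉Q))) ⟩
    p * (∣ D ∣ * N)          ≡⟨ x∙yz≈y∙xz p ∣ D ∣ N ⟩
    ∣ D ∣ * (p * N)          ≤⟨ ℕ.*-monoʳ-≤ ∣ D ∣ (ℕ.m≤m+n (p * N) (N * N)) ⟩
    ∣ D ∣ * (p * N + N * N)  ∎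
    where open ℕ.≤-Reasoning

  p*N²≤∣D∣*[p*N+N²] : 1 < ∣ Y ∣ → p * (N * N) ≤ ∣ D ∣ * (p * N + N * N)
  p*N²≤∣D∣*[p*N+N²] 1<∣Y∣ = let c , d , c∈Y , d∈Y , c≢d = 1<∣A∣⇒distinct 1<∣Y∣ in
    Sum.[ bound-if-Q-everywhere , (λ (ξ , ξ∈Q , ξ+1∉Q) → bound-if-Q-exits {ξ} ξ∈Q ξ+1∉Q) ]′
      (all-or-exit Q? (0∈Q {c} {d} c∈Y d∈Y c≢d))

-- P ↦ PN/(P + N) is increasing.
weaken-bound : ∀ N M P → P * (N * N) ≤ M * (P * N + N * N) → N * (P ∸ 1) ≤ M * (N + (P ∸ 1))
weaken-bound zero M P _ = z≤n
weaken-bound N@(suc _) M zero _ = ℕ.≤-trans (ℕ.≤-reflexive (ℕ.*-zeroʳ N)) z≤n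
weaken-bound N@(suc _) M (suc q) P*N²≤M[PN+N²] = ℕ.*-cancelʳ-≤ (N * q) (M * (N + q)) (suc (N + q)) (begin
  N * q * suc (N + q)              ≤⟨ ℕ.m≤m+n (N * q * suc (N + q)) (N * N) ⟩
  N * q * suc (N + q) + N * N      ≡⟨ regroupˡ N q ⟩
  suc q * N * (N + q)              ≤⟨ ℕ.*-monoˡ-≤ (N + q) P*N≤M[P+N] ⟩
  M * (suc q + N) * (N + q)        ≡⟨ regroupʳ M N q ⟩
  M * (N + q) * suc (N + q)        ∎)
  where
  open ℕ.≤-Reasoning
  regroupˡ : ∀ N q → N * q * suc (N + q) + N * N ≡ suc q * N * (N + q)
  regroupˡ = solve-∀
  regroupʳ : ∀ M N q → M * (suc q + N) * (N + q) ≡ M * (N + q) * suc (N + q)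
  regroupʳ = solve-∀
  factor-Nˡ : ∀ N q → suc q * (N * N) ≡ suc q * N * N
  factor-Nˡ = solve-∀
  factor-Nʳ : ∀ M N q → M * (suc q * N + N * N) ≡ M * (suc q + N) * N
  factor-Nʳ = solve-∀
  P*N≤M[P+N] : suc q * N ≤ M * (suc q + N)
  P*N≤M[P+N] = ℕ.*-cancelʳ-≤ (suc q * N) (M * (suc q + N)) N
    (subst₂ _≤_ (factor-Nˡ N q) (factor-Nʳ M N q) P*N²≤M[PN+N²])

corollary4 : (p : ℕ) .{{_ : NonZero p}} → Prime p → 2 < p →
    (Y : Subset p) → 1 < ∣ Y ∣ →
    ∣ Y ∣ * ∣ Y ∣ * (p ∸ 1) ≤ ∣ threeY²-threeY² Y ∣ * (∣ Y ∣ * ∣ Y ∣ + (p ∸ 1))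
corollary4 p p-prime _ Y 1<∣Y∣ =
  weaken-bound (∣ Y ∣ * ∣ Y ∣) ∣ D ∣ p
    (subst (λ N → p * (N * N) ≤ ∣ D ∣ * (p * N + N * N)) N≡∣Y∣² (p*N²≤∣D∣*[p*N+N²] 1<∣Y∣))
  where open SumProduct p p-prime Y
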